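{- The relation $\succeq^{+}$ satisfies the defining clauses of a strong 1-faster-than relation on all terms (including open terms): for all $(P,Q)\in\succeq^{+}$ and $\alpha\in\mathcal A$, (1) $P\xrightarrow{\alpha}P'$ implies $Q\xrightarrow{\alpha}Q'$ for some $Q'$ with $P'\succeq^{+}Q'$; (2) $Q\xrightarrow{\alpha}Q'$ implies $P\xrightarrow{\alpha}P'$ for some $P'$ with $P'\succeq^{+}Q'$; (3) $P\xrightarrow{\sigma}_1P'$ implies $\mathcal U(Q)\subseteq\mathcal U(P)$ and $Q\xrightarrow{\sigma}_1Q'$ for some $Q'$ with $P'\succeq^{+}Q'$. Consequently, $\succeq^{+}\cap(\mathcal P\times\mathcal P)$ is a strong 1-faster-than relation and $\succeq^{+}\cap(\mathcal P\times\mathcal P)\subseteq\sqsupseteq_{1}$.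
   Context: TACS. Fix a countable set $\Lambda$ of action names; $\overline{\Lambda}=\{\overline a : a\in\Lambda\}$ with $\overline{\overline a}=a$; $\mathcal A=\Lambda\cup\overline\Lambda\cup\{\tau\}$ (ranged over by $\alpha$), and $a$ ranges over $\Lambda\cup\overline\Lambda$. Terms (set $\widehat{\mathcal P}$, possibly open) are generated by $P::=\mathbf 0\mid x\mid \alpha.P\mid \sigma.P\mid P+P\mid P|P\mid P\backslash L\mid P[f]\mid \mu x.P$, where $x$ ranges over a countably infinite set of variables, $L\subseteq\mathcal A\setminus\{\tau\}$ is finite, and $f:\mathcal A\to\mathcal A$ satisfies $f(\tau)=\tau$, $f(\overline a)=\overline{f(a)}$ and $f(\alpha)\neq\alpha$ for only finitely many $\alpha$. $\mu x$ binds $x$; $P[Q/x]$ is substitution of $Q$ for the free occurrences of $x$. A variable is guarded in a term if each of its occurrences is in the scope of an action prefix $\alpha.\_$ (a $\sigma$-prefix does not count); in every term $\mu x.P$, $x$ must be guarded in $P$. Processes (set $\mathcal P$) are the closed terms. $\overline L=\{\overline a: a\in L\}$. Urgent sets: $\mathcal U(\sigma.P)=\mathcal U(\mathbf 0)=\mathcal U(x)=\emptyset$, $\mathcal U(\alpha.P)=\{\alpha\}$, $\mathcal U(P+Q)=\mathcal U(P)\cup\mathcal U(Q)$, $\mathcal U(P|Q)=\mathcal U(P)\cup\mathcal U(Q)\cup\{\tau\mid \mathcal U(P)\cap\overline{\mathcal U(Q)}\neq\emptyset\}$, $\mathcal U(P\backslash L)=\mathcal U(P)\setminus(L\cup\overline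 L)$, $\mathcal U(P[f])=\{f(\alpha):\alpha\in\mathcal U(P)\}$, $\mathcal U(\mu x.P)=\mathcal U(P)$. Action transitions $\xrightarrow{\alpha}$ are the least relations with: $\alpha.P\xrightarrow{\alpha}P$; if $P\xrightarrow{\alpha}P'$ then $\sigma.P\xrightarrow{\alpha}P'$, $\mu x.P\xrightarrow{\alpha}P'[\mu x.P/x]$, $P+Q\xrightarrow{\alpha}P'$, $Q+P\xrightarrow{\alpha}P'$, $P|Q\xrightarrow{\alpha}P'|Q$, $Q|P\xrightarrow{\alpha}Q|P'$, $P[f]\xrightarrow{f(\alpha)}P'[f]$, and $P\backslash L\xrightarrow{\alpha}P'\backslash L$ if $\alpha\notin L\cup\overline L$; if $P\xrightarrow{a}P'$ and $Q\xrightarrow{\overline a}Q'$ then $P|Q\xrightarrow{\tau}P'|Q'$. Clock transitions $\xrightarrow{\sigma}_1$ form the least relation with: $\mathbf 0\xrightarrow{\sigma}_1\mathbf 0$; $a.P\xrightarrow{\sigma}_1 a.P$ for $a\in\Lambda\cup\overline\Lambda$; $\sigma.P\xrightarrow{\sigma}_1P$; if $P\xrightarrow{\sigma}_1P'$ then $\mu x.P\xrightarrow{\sigma}_1P'[\mu x.P/x]$, $P\backslash L\xrightarrow{\sigma}_1P'\backslash L$, $P[f]\xrightarrow{\sigma}_1P'[f]$; if $P\xrightarrow{\sigma}_1P'$ and $Q\xrightarrow{\sigma}_1Q'$ then $P+Q\xrightarrow{\sigma}_1P'+Q'$, and $P|Q\xrightarrow{\sigma}_1P'|Q'$ provided $\tau\notin\mathcal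 U(P|Q)$. A relation $\mathcal R\subseteq\mathcal P\times\mathcal P$ is a strong 1-faster-than relation if for all $(P,Q)\in\mathcal R$, $\alpha\in\mathcal A$: (1) $P\xrightarrow{\alpha}P'$ implies $\exists Q'$. $Q\xrightarrow{\alpha}Q'$, $(P',Q')\in\mathcal R$; (2) $Q\xrightarrow{\alpha}Q'$ implies $\exists P'$. $P\xrightarrow{\alpha}P'$, $(P',Q')\in\mathcal R$; (3) $P\xrightarrow{\sigma}_1P'$ implies $\mathcal U(Q)\subseteq\mathcal U(P)$ and $\exists Q'$. $Q\xrightarrow{\sigma}_1Q'$, $(P',Q')\in\mathcal R$. $P\sqsupseteq_{1}Q$ iff $(P,Q)$ lies in some strong 1-faster-than relation. The syntactic relation $\succeq\subseteq\widehat{\mathcal P}\times\widehat{\mathcal P}$ is the smallest relation such that for all terms: $P\succeq P$; $P\succeq\sigma.P$; if $P'\succeq P$ and $Q'\succeq Q$ then $P'|Q'\succeq P|Q$ and $P'+Q'\succeq P+Q$; if $P'\succeq P$ then $P'\backslash L\succeq P\backslash L$ and $P'[f]\succeq P[f]$; if $P'\succeq P$ and $x$ is guarded in $P$ then $P'[\mu x.P/x]\succeq\mu x.P$. $\succeq^{+}$ denotes the transitive closure of $\succeq$. -}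

module Defs where

open import Data.Nat using (ℕ; zero; suc)
open import Data.Fin using (Fin; zero; suc)
open import Data.List using (List)
open import Data.List.Membership.Propositional using (_∈_)
open import Data.Product using (Σ; _×_; _,_)
open import Data.Sum using (_⊎_)
open import Data.Empty using (⊥)
open import Relation.Nullary using (¬_)
open import Relation.Binary.PropositionalEquality using (_≡_; _≢_)
open import Relation.Binary.Construct.Closure.Transitive using (TransClosure)

-- Actions.  Λ (action names) is fixed to be ℕ (a countable set).

data Label : Set where
  inp : ℕ → Label
  out : ℕ → Label

bar : Label → Label
bar (inp a) = out a
bar (out a) = inp a

data Act : Set where
  τ   : Act
  vis : Label → Act

-- Since overline is only defined
-- on visible actions, f maps visible actions to visible actions; we
-- therefore give f by its action on visible labels and extend by τ ↦ τ.

record Relabel : Set where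
  field
    fn     : Label → Label
    fn-bar : ∀ a → fn (bar a) ≡ bar (fn a)
    fn-fin : Σ (List Label) λ xs → ∀ a → fn a ≢ a → a ∈ xs

applyR : Relabel → Act → Act
applyR f τ       = τ
applyR f (vis a) = vis (Relabel.fn f a)

-- Terms, possibly open, in scoped de Bruijn form: Term n has free
-- variables among Fin n; μ binds variable zero.  Restriction sets L are
-- finite subsets of 𝒜 ∖ {τ}, given as lists of labels.

infixr 6 _∙_ σ∙_
infixl 5 _⊕_
infixl 4 _∥_

data Term (n : ℕ) : Set where
  𝟎    : Term n
  var  : Fin n → Term n
  _∙_  : Act → Term n → Term n
  σ∙_  : Term n → Term n
  _⊕_  : Term n → Term n → Term n
  _∥_  : Term n → Term n → Term n
  _∖_  : Term n → List Label → Term n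
  _[_] : Term n → Relabel → Term n
  μ    : Term (suc n) → Term n

Process : Set
Process = Term 0

ext : ∀ {m n} → (Fin m → Fin n) → Fin (suc m) → Fin (suc n)
ext ρ zero    = zero
ext ρ (suc i) = suc (ρ i)

rename : ∀ {m n} → (Fin m → Fin n) → Term m → Term n
rename ρ 𝟎         = 𝟎
rename ρ (var i)   = var (ρ i)
rename ρ (α ∙ P)   = α ∙ rename ρ P
rename ρ (σ∙ P)    = σ∙ rename ρ P
rename ρ (P ⊕ Q)   = rename ρ P ⊕ rename ρ Q
rename ρ (P ∥ Q)   = rename ρ P ∥ rename ρ Q
rename ρ (P ∖ L)   = rename ρ P ∖ L
rename ρ (P [ f ]) = rename ρ P [ f ]
rename ρ (μ P)     = μ (rename (ext ρ) P)

exts : ∀ {m n} → (Fin m → Term n) → Fin (suc m) → Term (suc n)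
exts s zero    = var zero
exts s (suc i) = rename suc (s i)

subst : ∀ {m n} → (Fin m → Term n) → Term m → Term n
subst s 𝟎         = 𝟎
subst s (var i)   = s i
subst s (α ∙ P)   = α ∙ subst s P
subst s (σ∙ P)    = σ∙ subst s P
subst s (P ⊕ Q)   = subst s P ⊕ subst s Q
subst s (P ∥ Q)   = subst s P ∥ subst s Q
subst s (P ∖ L)   = subst s P ∖ L
subst s (P [ f ]) = subst s P [ f ]
subst s (μ P)     = μ (subst (exts s) P)

sub₀ : ∀ {n} → Term n → Fin (suc n) → Term n
sub₀ Q zero    = Q
sub₀ Q (suc i) = var i

_⟨_⟩ : ∀ {n} → Term (suc n) → Term n → Term n
P ⟨ Q ⟩ = subst (sub₀ Q) P

-- Guardedness: every occurrence of x is in the scope of an action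
-- prefix α._ (σ-prefixes do not count).

data Guarded {n} (x : Fin n) : Term n → Set where
  g𝟎   : Guarded x 𝟎
  gvar : ∀ {y} → y ≢ x → Guarded x (var y)
  gact : ∀ {α P} → Guarded x (α ∙ P)
  gσ   : ∀ {P} → Guarded x P → Guarded x (σ∙ P)
  g⊕   : ∀ {P Q} → Guarded x P → Guarded x Q → Guarded x (P ⊕ Q)
  g∥   : ∀ {P Q} → Guarded x P → Guarded x Q → Guarded x (P ∥ Q)
  g∖   : ∀ {P L} → Guarded x P → Guarded x (P ∖ L)
  g[]  : ∀ {P f} → Guarded x P → Guarded x (P [ f ])
  gμ   : ∀ {P} → Guarded (suc x) P → Guarded x (μ P)

data WF {n} : Term n → Set where
  wf𝟎   : WF 𝟎
  wfvar : ∀ {i} → WF (var i)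
  wfact : ∀ {α P} → WF P → WF (α ∙ P)
  wfσ   : ∀ {P} → WF P → WF (σ∙ P)
  wf⊕   : ∀ {P Q} → WF P → WF Q → WF (P ⊕ Q)
  wf∥   : ∀ {P Q} → WF P → WF Q → WF (P ∥ Q)
  wf∖   : ∀ {P L} → WF P → WF (P ∖ L)
  wf[]  : ∀ {P f} → WF P → WF (P [ f ])
  wfμ   : ∀ {P} → Guarded zero P → WF P → WF (μ P)

InRes : Act → List Label → Set
InRes τ       L = ⊥
InRes (vis a) L = a ∈ L ⊎ bar a ∈ L

-- Urgent sets, as predicates:  𝒰 P α  means  α ∈ 𝒰(P)
𝒰 : ∀ {n} → Term n → Act → Set
𝒰 𝟎         α = ⊥
𝒰 (var x)   α = ⊥
𝒰 (β ∙ P)   α = α ≡ β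
𝒰 (σ∙ P)    α = ⊥
𝒰 (P ⊕ Q)   α = 𝒰 P α ⊎ 𝒰 Q α
𝒰 (P ∥ Q)   α = 𝒰 P α ⊎ 𝒰 Q α
                ⊎ (α ≡ τ × Σ Label λ a → 𝒰 P (vis a) × 𝒰 Q (vis (bar a)))
𝒰 (P ∖ L)   α = 𝒰 P α × ¬ InRes α L
𝒰 (P [ f ]) α = Σ Act λ β → 𝒰 P β × applyR f β ≡ α
𝒰 (μ P)     α = 𝒰 P α

_⊆U_ : ∀ {n} → Term n → Term n → Set
Q ⊆U P = ∀ α → 𝒰 Q α → 𝒰 P α

infix 3 _—[_]→_ _—σ→_

data _—[_]→_ {n} : Term n → Act → Term n → Set where
  pre   : ∀ {α P} → (α ∙ P) —[ α ]→ P
  delay : ∀ {α P P'} → P —[ α ]→ P' → (σ∙ P) —[ α ]→ P'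
  rec   : ∀ {α P P'} → P —[ α ]→ P' → μ P —[ α ]→ (P' ⟨ μ P ⟩)
  sumₗ  : ∀ {α P P' Q} → P —[ α ]→ P' → (P ⊕ Q) —[ α ]→ P'
  sumᵣ  : ∀ {α P P' Q} → P —[ α ]→ P' → (Q ⊕ P) —[ α ]→ P'
  parₗ  : ∀ {α P P' Q} → P —[ α ]→ P' → (P ∥ Q) —[ α ]→ (P' ∥ Q)
  parᵣ  : ∀ {α P P' Q} → P —[ α ]→ P' → (Q ∥ P) —[ α ]→ (Q ∥ P')
  rel   : ∀ {α P P' f} → P —[ α ]→ P' → (P [ f ]) —[ applyR f α ]→ (P' [ f ])
  res   : ∀ {α P P' L} → ¬ InRes α L → P —[ α ]→ P' → (P ∖ L) —[ α ]→ (P' ∖ L)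
  com   : ∀ {a P P' Q Q'} → P —[ vis a ]→ P' → Q —[ vis (bar a) ]→ Q'
          → (P ∥ Q) —[ τ ]→ (P' ∥ Q')

data _—σ→_ {n} : Term n → Term n → Set where
  nil   : 𝟎 —σ→ 𝟎
  idle  : ∀ {a P} → (vis a ∙ P) —σ→ (vis a ∙ P)
  tick  : ∀ {P} → (σ∙ P) —σ→ P
  rec   : ∀ {P P'} → P —σ→ P' → μ P —σ→ (P' ⟨ μ P ⟩)
  res   : ∀ {P P' L} → P —σ→ P' → (P ∖ L) —σ→ (P' ∖ L)
  rel   : ∀ {P P' f} → P —σ→ P' → (P [ f ]) —σ→ (P' [ f ])
  sum   : ∀ {P P' Q Q'} → P —σ→ P' → Q —σ→ Q' → (P ⊕ Q) —σ→ (P' ⊕ Q')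
  par   : ∀ {P P' Q Q'} → P —σ→ P' → Q —σ→ Q' → ¬ 𝒰 (P ∥ Q) τ
          → (P ∥ Q) —σ→ (P' ∥ Q')

FasterClauses : ∀ {n} → (Term n → Term n → Set) → Term n → Term n → Set
FasterClauses R P Q =
    (∀ α P' → P —[ α ]→ P' → Σ (Term _) λ Q' → (Q —[ α ]→ Q') × R P' Q')
  × (∀ α Q' → Q —[ α ]→ Q' → Σ (Term _) λ P' → (P —[ α ]→ P') × R P' Q')
  × (∀ P' → P —σ→ P' → Q ⊆U P × (Σ (Term _) λ Q' → (Q —σ→ Q') × R P' Q'))

IsStrong1Faster : (Process → Process → Set) → Set
IsStrong1Faster R = ∀ P Q → R P Q → FasterClauses R P Q

_⊒₁_ : Process → Process → Set₁
P ⊒₁ Q = Σ (Process → Process → Set) λ R → IsStrong1Faster R × R P Q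

infix 4 _⪰_ _⪰⁺_

data _⪰_ {n} : Term n → Term n → Set where
  ⪰refl  : ∀ {P} → WF P → P ⪰ P
  ⪰σ     : ∀ {P} → WF P → P ⪰ σ∙ P
  ⪰par   : ∀ {P P' Q Q'} → P' ⪰ P → Q' ⪰ Q → (P' ∥ Q') ⪰ (P ∥ Q)
  ⪰sum   : ∀ {P P' Q Q'} → P' ⪰ P → Q' ⪰ Q → (P' ⊕ Q') ⪰ (P ⊕ Q)
  ⪰res   : ∀ {P P' L} → P' ⪰ P → (P' ∖ L) ⪰ (P ∖ L)
  ⪰rel   : ∀ {P P' f} → P' ⪰ P → (P' [ f ]) ⪰ (P [ f ])
  ⪰rec   : ∀ {P P'} → P' ⪰ P → Guarded zero P → (P' ⟨ μ P ⟩) ⪰ μ P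

_⪰⁺_ : ∀ {n} → Term n → Term n → Set
_⪰⁺_ = TransClosure _⪰_

-- Each single ⪰-step satisfies the three clauses with ⪰ itself as target relation, and the
-- clauses compose along chains, which gives them for ⪰⁺. The only substantial case of the
-- induction on ⪰ is the unfolding P′[μx.P/x] ⪰ μx.P. Since x is guarded in P′ (as in P),
-- substituting for x neither creates nor removes transitions, so every move of P′[μx.P/x] is a
-- move P′ → Y with μx.P substituted; μx.P matches it through P → Z with Y ⪰ Z, and closure of
-- ⪰ under substitution gives Y[μx.P/x] ⪰ Z[μx.P/x].
module Submission where

open import Defs
open import Data.Nat using (ℕ; suc)
open import Data.Fin using (Fin; zero; suc)
open import Data.Fin.Properties using (_≟_; suc-injective)
open import Data.Product using (Σ; _×_; _,_)
open import Data.Sum using (_⊎_; inj₁; inj₂; map; map₁)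
open import Data.Empty using (⊥-elim)
open import Function using (_∘_; flip)
open import Relation.Nullary using (¬_; yes; no)
open import Relation.Binary.PropositionalEquality
  using (_≡_; _≢_; _≗_; refl; sym; trans; cong; cong₂; module ≡-Reasoning)
open import Relation.Binary.Construct.Closure.Transitive using (TransClosure; _∷_) renaming ([_] to [_]⁺)

private
  variable
    k m n : ℕ
    α : Act
    P P′ Q Q′ X : Term n

ext-cong : {ρ ρ′ : Fin m → Fin n} → ρ ≗ ρ′ → ext ρ ≗ ext ρ′
ext-cong e zero    = refl
ext-cong e (suc i) = cong suc (e i)

rename-cong : {ρ ρ′ : Fin m → Fin n} → ρ ≗ ρ′ → rename ρ ≗ rename ρ′
rename-cong e 𝟎         = refl
rename-cong e (var i)   = cong var (e i)
rename-cong e (α ∙ P)   = cong (α ∙_) (rename-cong e P)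
rename-cong e (σ∙ P)    = cong σ∙_ (rename-cong e P)
rename-cong e (P ⊕ Q)   = cong₂ _⊕_ (rename-cong e P) (rename-cong e Q)
rename-cong e (P ∥ Q)   = cong₂ _∥_ (rename-cong e P) (rename-cong e Q)
rename-cong e (P ∖ L)   = cong (_∖ L) (rename-cong e P)
rename-cong e (P [ f ]) = cong (_[ f ]) (rename-cong e P)
rename-cong e (μ P)     = cong μ (rename-cong (ext-cong e) P)

exts-cong : {s t : Fin m → Term n} → s ≗ t → exts s ≗ exts t
exts-cong e zero    = refl
exts-cong e (suc i) = cong (rename suc) (e i)

subst-cong : {s t : Fin m → Term n} → s ≗ t → subst s ≗ subst t
subst-cong e 𝟎         = refl
subst-cong e (var i)   = e i
subst-cong e (α ∙ P)   = cong (α ∙_) (subst-cong e P)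
subst-cong e (σ∙ P)    = cong σ∙_ (subst-cong e P)
subst-cong e (P ⊕ Q)   = cong₂ _⊕_ (subst-cong e P) (subst-cong e Q)
subst-cong e (P ∥ Q)   = cong₂ _∥_ (subst-cong e P) (subst-cong e Q)
subst-cong e (P ∖ L)   = cong (_∖ L) (subst-cong e P)
subst-cong e (P [ f ]) = cong (_[ f ]) (subst-cong e P)
subst-cong e (μ P)     = cong μ (subst-cong (exts-cong e) P)

rename-rename : (ρ : Fin m → Fin n) (ρ′ : Fin k → Fin m) →
                rename ρ ∘ rename ρ′ ≗ rename (ρ ∘ ρ′)
rename-rename ρ ρ′ 𝟎         = refl
rename-rename ρ ρ′ (var i)   = refl
rename-rename ρ ρ′ (α ∙ P)   = cong (α ∙_) (rename-rename ρ ρ′ P)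
rename-rename ρ ρ′ (σ∙ P)    = cong σ∙_ (rename-rename ρ ρ′ P)
rename-rename ρ ρ′ (P ⊕ Q)   = cong₂ _⊕_ (rename-rename ρ ρ′ P) (rename-rename ρ ρ′ Q)
rename-rename ρ ρ′ (P ∥ Q)   = cong₂ _∥_ (rename-rename ρ ρ′ P) (rename-rename ρ ρ′ Q)
rename-rename ρ ρ′ (P ∖ L)   = cong (_∖ L) (rename-rename ρ ρ′ P)
rename-rename ρ ρ′ (P [ f ]) = cong (_[ f ]) (rename-rename ρ ρ′ P)
rename-rename ρ ρ′ (μ P)     =
  cong μ (trans (rename-rename (ext ρ) (ext ρ′) P) (rename-cong ext-∘ P))
  where
  ext-∘ : ext ρ ∘ ext ρ′ ≗ ext (ρ ∘ ρ′)
  ext-∘ zero    = refl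
  ext-∘ (suc i) = refl

subst-rename : (s : Fin m → Term n) (ρ : Fin k → Fin m) →
               subst s ∘ rename ρ ≗ subst (s ∘ ρ)
subst-rename s ρ 𝟎         = refl
subst-rename s ρ (var i)   = refl
subst-rename s ρ (α ∙ P)   = cong (α ∙_) (subst-rename s ρ P)
subst-rename s ρ (σ∙ P)    = cong σ∙_ (subst-rename s ρ P)
subst-rename s ρ (P ⊕ Q)   = cong₂ _⊕_ (subst-rename s ρ P) (subst-rename s ρ Q)
subst-rename s ρ (P ∥ Q)   = cong₂ _∥_ (subst-rename s ρ P) (subst-rename s ρ Q)
subst-rename s ρ (P ∖ L)   = cong (_∖ L) (subst-rename s ρ P)
subst-rename s ρ (P [ f ]) = cong (_[ f ]) (subst-rename s ρ P)
subst-rename s ρ (μ P)     =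
  cong μ (trans (subst-rename (exts s) (ext ρ) P) (subst-cong exts-ext P))
  where
  exts-ext : exts s ∘ ext ρ ≗ exts (s ∘ ρ)
  exts-ext zero    = refl
  exts-ext (suc i) = refl

rename-subst : (ρ : Fin m → Fin n) (s : Fin k → Term m) →
               rename ρ ∘ subst s ≗ subst (rename ρ ∘ s)
rename-subst ρ s 𝟎         = refl
rename-subst ρ s (var i)   = refl
rename-subst ρ s (α ∙ P)   = cong (α ∙_) (rename-subst ρ s P)
rename-subst ρ s (σ∙ P)    = cong σ∙_ (rename-subst ρ s P)
rename-subst ρ s (P ⊕ Q)   = cong₂ _⊕_ (rename-subst ρ s P) (rename-subst ρ s Q)
rename-subst ρ s (P ∥ Q)   = cong₂ _∥_ (rename-subst ρ s P) (rename-subst ρ s Q)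
rename-subst ρ s (P ∖ L)   = cong (_∖ L) (rename-subst ρ s P)
rename-subst ρ s (P [ f ]) = cong (_[ f ]) (rename-subst ρ s P)
rename-subst ρ s (μ P)     =
  cong μ (trans (rename-subst (ext ρ) (exts s) P) (subst-cong ext-exts P))
  where
  ext-exts : rename (ext ρ) ∘ exts s ≗ exts (rename ρ ∘ s)
  ext-exts zero    = refl
  ext-exts (suc i) = trans (rename-rename (ext ρ) suc (s i)) (sym (rename-rename suc ρ (s i)))

subst-subst : (s : Fin m → Term n) (t : Fin k → Term m) →
              subst s ∘ subst t ≗ subst (subst s ∘ t)
subst-subst s t 𝟎         = refl
subst-subst s t (var i)   = refl
subst-subst s t (α ∙ P)   = cong (α ∙_) (subst-subst s t P)
subst-subst s t (σ∙ P)    = cong σ∙_ (subst-subst s t P)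
subst-subst s t (P ⊕ Q)   = cong₂ _⊕_ (subst-subst s t P) (subst-subst s t Q)
subst-subst s t (P ∥ Q)   = cong₂ _∥_ (subst-subst s t P) (subst-subst s t Q)
subst-subst s t (P ∖ L)   = cong (_∖ L) (subst-subst s t P)
subst-subst s t (P [ f ]) = cong (_[ f ]) (subst-subst s t P)
subst-subst s t (μ P)     =
  cong μ (trans (subst-subst (exts s) (exts t) P) (subst-cong exts-exts P))
  where
  exts-exts : subst (exts s) ∘ exts t ≗ exts (subst s ∘ t)
  exts-exts zero    = refl
  exts-exts (suc i) = trans (subst-rename (exts s) suc (t i)) (sym (rename-subst suc s (t i)))

subst-id : subst {n} var ≗ (λ P → P)
subst-id 𝟎         = refl
subst-id (var i)   = refl
subst-id (α ∙ P)   = cong (α ∙_) (subst-id P)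
subst-id (σ∙ P)    = cong σ∙_ (subst-id P)
subst-id (P ⊕ Q)   = cong₂ _⊕_ (subst-id P) (subst-id Q)
subst-id (P ∥ Q)   = cong₂ _∥_ (subst-id P) (subst-id Q)
subst-id (P ∖ L)   = cong (_∖ L) (subst-id P)
subst-id (P [ f ]) = cong (_[ f ]) (subst-id P)
subst-id (μ P)     = cong μ (trans (subst-cong exts-var P) (subst-id P))
  where
  exts-var : exts var ≗ var
  exts-var zero    = refl
  exts-var (suc i) = refl

subst-⟨⟩ : (s : Fin m → Term n) (P : Term (suc m)) (R : Term m) →
           subst s (P ⟨ R ⟩) ≡ subst (exts s) P ⟨ subst s R ⟩
subst-⟨⟩ s P R = begin
  subst s (subst (sub₀ R) P)                   ≡⟨ subst-subst s (sub₀ R) P ⟩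
  subst (subst s ∘ sub₀ R) P                   ≡⟨ subst-cong sub₀-exts P ⟩
  subst (subst (sub₀ (subst s R)) ∘ exts s) P  ≡⟨ subst-subst (sub₀ (subst s R)) (exts s) P ⟨
  subst (sub₀ (subst s R)) (subst (exts s) P)  ∎
  where
  open ≡-Reasoning
  sub₀-exts : subst s ∘ sub₀ R ≗ subst (sub₀ (subst s R)) ∘ exts s
  sub₀-exts zero    = refl
  sub₀-exts (suc i) = sym (trans (subst-rename (sub₀ (subst s R)) suc (s i)) (subst-id (s i)))

OnUnguarded : (Fin m → Set) → Term m → Set
OnUnguarded A P = ∀ i → Guarded i P ⊎ A i

module _ {A : Fin m → Set} where

  onUnguarded-σ : OnUnguarded A (σ∙ P) → OnUnguarded A P
  onUnguarded-σ h i = map₁ (λ { (gσ g) → g }) (h i)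

  onUnguarded-⊕ˡ : OnUnguarded A (P ⊕ Q) → OnUnguarded A P
  onUnguarded-⊕ˡ h i = map₁ (λ { (g⊕ g _) → g }) (h i)

  onUnguarded-⊕ʳ : OnUnguarded A (P ⊕ Q) → OnUnguarded A Q
  onUnguarded-⊕ʳ h i = map₁ (λ { (g⊕ _ g) → g }) (h i)

  onUnguarded-∥ˡ : OnUnguarded A (P ∥ Q) → OnUnguarded A P
  onUnguarded-∥ˡ h i = map₁ (λ { (g∥ g _) → g }) (h i)

  onUnguarded-∥ʳ : OnUnguarded A (P ∥ Q) → OnUnguarded A Q
  onUnguarded-∥ʳ h i = map₁ (λ { (g∥ _ g) → g }) (h i)

  onUnguarded-∖ : ∀ {L} → OnUnguarded A (P ∖ L) → OnUnguarded A P
  onUnguarded-∖ h i = map₁ (λ { (g∖ g) → g }) (h i)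

  onUnguarded-[] : ∀ {f} → OnUnguarded A (P [ f ]) → OnUnguarded A P
  onUnguarded-[] h i = map₁ (λ { (g[] g) → g }) (h i)

guarded-rename : (ρ : Fin m → Fin n) {z : Fin n} (P : Term m) →
                 OnUnguarded (λ i → ρ i ≢ z) P → Guarded z (rename ρ P)
guarded-rename ρ 𝟎         h = g𝟎
guarded-rename ρ (var i)   h with h i
... | inj₁ (gvar ne) = ⊥-elim (ne refl)
... | inj₂ ne        = gvar ne
guarded-rename ρ (α ∙ P)   h = gact
guarded-rename ρ (σ∙ P)    h = gσ (guarded-rename ρ P (onUnguarded-σ h))
guarded-rename ρ (P ⊕ Q)   h =
  g⊕ (guarded-rename ρ P (onUnguarded-⊕ˡ h)) (guarded-rename ρ Q (onUnguarded-⊕ʳ h))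
guarded-rename ρ (P ∥ Q)   h =
  g∥ (guarded-rename ρ P (onUnguarded-∥ˡ h)) (guarded-rename ρ Q (onUnguarded-∥ʳ h))
guarded-rename ρ (P ∖ L)   h = g∖ (guarded-rename ρ P (onUnguarded-∖ h))
guarded-rename ρ (P [ f ]) h = g[] (guarded-rename ρ P (onUnguarded-[] h))
guarded-rename ρ (μ P)     h = gμ (guarded-rename (ext ρ) P h′)
  where
  h′ : OnUnguarded (λ i → ext ρ i ≢ suc _) P
  h′ zero    = inj₂ λ ()
  h′ (suc i) = map (λ { (gμ g) → g }) (λ ne → ne ∘ suc-injective) (h i)

guarded-weaken : {y : Fin n} (P : Term n) → Guarded y P → Guarded (suc y) (rename suc P)
guarded-weaken {y = y} P g = guarded-rename suc P h
  where
  h : OnUnguarded (λ i → suc i ≢ suc y) P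
  h i with i ≟ y
  ... | yes refl = inj₁ g
  ... | no ne    = inj₂ (ne ∘ suc-injective)

guarded-fresh : (P : Term n) → Guarded zero (rename suc P)
guarded-fresh P = guarded-rename suc P λ _ → inj₂ λ ()

guarded-subst : (s : Fin m → Term n) {y : Fin n} (P : Term m) →
                OnUnguarded (λ i → Guarded y (s i)) P → Guarded y (subst s P)
guarded-subst s 𝟎         h = g𝟎
guarded-subst s (var i)   h with h i
... | inj₁ (gvar ne) = ⊥-elim (ne refl)
... | inj₂ g         = g
guarded-subst s (α ∙ P)   h = gact
guarded-subst s (σ∙ P)    h = gσ (guarded-subst s P (onUnguarded-σ h))
guarded-subst s (P ⊕ Q)   h =
  g⊕ (guarded-subst s P (onUnguarded-⊕ˡ h)) (guarded-subst s Q (onUnguarded-⊕ʳ h))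
guarded-subst s (P ∥ Q)   h =
  g∥ (guarded-subst s P (onUnguarded-∥ˡ h)) (guarded-subst s Q (onUnguarded-∥ʳ h))
guarded-subst s (P ∖ L)   h = g∖ (guarded-subst s P (onUnguarded-∖ h))
guarded-subst s (P [ f ]) h = g[] (guarded-subst s P (onUnguarded-[] h))
guarded-subst s (μ P)     h = gμ (guarded-subst (exts s) P h′)
  where
  h′ : OnUnguarded (λ i → Guarded (suc _) (exts s i)) P
  h′ zero    = inj₂ (gvar λ ())
  h′ (suc i) = map (λ { (gμ g) → g }) (guarded-weaken (s i)) (h i)

guarded-subst-exts : (s : Fin m → Term n) (P : Term (suc m)) →
                     Guarded zero P → Guarded zero (subst (exts s) P)
guarded-subst-exts s P g = guarded-subst (exts s) P h
  where
  h : OnUnguarded (λ i → Guarded zero (exts s i)) P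
  h zero    = inj₁ g
  h (suc i) = inj₂ (guarded-fresh (s i))

wf-rename : (ρ : Fin m → Fin n) → WF P → WF (rename ρ P)
wf-rename ρ wf𝟎        = wf𝟎
wf-rename ρ wfvar      = wfvar
wf-rename ρ (wfact w)  = wfact (wf-rename ρ w)
wf-rename ρ (wfσ w)    = wfσ (wf-rename ρ w)
wf-rename ρ (wf⊕ w w′) = wf⊕ (wf-rename ρ w) (wf-rename ρ w′)
wf-rename ρ (wf∥ w w′) = wf∥ (wf-rename ρ w) (wf-rename ρ w′)
wf-rename ρ (wf∖ w)    = wf∖ (wf-rename ρ w)
wf-rename ρ (wf[] w)   = wf[] (wf-rename ρ w)
wf-rename ρ (wfμ {P} g w) = wfμ (guarded-rename (ext ρ) P h) (wf-rename (ext ρ) w)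
  where
  h : OnUnguarded (λ i → ext ρ i ≢ zero) P
  h zero    = inj₁ g
  h (suc i) = inj₂ λ ()

wf-exts : {s : Fin m → Term n} → (∀ i → WF (s i)) → ∀ i → WF (exts s i)
wf-exts ws zero    = wfvar
wf-exts ws (suc i) = wf-rename suc (ws i)

wf-subst : (s : Fin m → Term n) → (∀ i → WF (s i)) → WF P → WF (subst s P)
wf-subst s ws wf𝟎          = wf𝟎
wf-subst s ws (wfvar {i})  = ws i
wf-subst s ws (wfact w)    = wfact (wf-subst s ws w)
wf-subst s ws (wfσ w)      = wfσ (wf-subst s ws w)
wf-subst s ws (wf⊕ w w′)   = wf⊕ (wf-subst s ws w) (wf-subst s ws w′)
wf-subst s ws (wf∥ w w′)   = wf∥ (wf-subst s ws w) (wf-subst s ws w′)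
wf-subst s ws (wf∖ w)      = wf∖ (wf-subst s ws w)
wf-subst s ws (wf[] w)     = wf[] (wf-subst s ws w)
wf-subst s ws (wfμ {P} g w) =
  wfμ (guarded-subst-exts s P g) (wf-subst (exts s) (wf-exts ws) w)

wf-sub₀ : WF P → ∀ i → WF (sub₀ P i)
wf-sub₀ w zero    = w
wf-sub₀ w (suc i) = wfvar

𝒰-subst : (s : Fin m → Term n) (P : Term m) → ∀ α → 𝒰 P α → 𝒰 (subst s P) α
𝒰-subst s (β ∙ P)   α u                 = u
𝒰-subst s (P ⊕ Q)   α (inj₁ u)          = inj₁ (𝒰-subst s P α u)
𝒰-subst s (P ⊕ Q)   α (inj₂ u)          = inj₂ (𝒰-subst s Q α u)
𝒰-subst s (P ∥ Q)   α (inj₁ u)          = inj₁ (𝒰-subst s P α u)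
𝒰-subst s (P ∥ Q)   α (inj₂ (inj₁ u))   = inj₂ (inj₁ (𝒰-subst s Q α u))
𝒰-subst s (P ∥ Q)   α (inj₂ (inj₂ (e , a , u , v))) =
  inj₂ (inj₂ (e , a , 𝒰-subst s P _ u , 𝒰-subst s Q _ v))
𝒰-subst s (P ∖ L)   α (u , r)           = 𝒰-subst s P α u , r
𝒰-subst s (P [ f ]) α (β , u , e)       = β , 𝒰-subst s P β u , e
𝒰-subst s (μ P)     α u                 = 𝒰-subst (exts s) P α u

step-subst : (s : Fin m → Term n) → P —[ α ]→ P′ → subst s P —[ α ]→ subst s P′
step-subst s pre       = pre
step-subst s (delay t) = delay (step-subst s t)
step-subst s (rec {P = P} {P′} t) rewrite subst-⟨⟩ s P′ (μ P) = rec (step-subst (exts s) t)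
step-subst s (sumₗ t)  = sumₗ (step-subst s t)
step-subst s (sumᵣ t)  = sumᵣ (step-subst s t)
step-subst s (parₗ t)  = parₗ (step-subst s t)
step-subst s (parᵣ t)  = parᵣ (step-subst s t)
step-subst s (rel t)   = rel (step-subst s t)
step-subst s (res r t) = res r (step-subst s t)
step-subst s (com t u) = com (step-subst s t) (step-subst s u)

IsVar : Term n → Set
IsVar {n} P = Σ (Fin n) λ j → P ≡ var j

-- A substitution replacing each unguarded variable of P by a variable neither creates nor
-- removes transitions of P.
Inert : (Fin m → Term n) → Term m → Set
Inert s = OnUnguarded (IsVar ∘ s)

inert-μ : (s : Fin m → Term n) (P : Term (suc m)) → Inert s (μ P) → Inert (exts s) P
inert-μ s P h zero    = inj₂ (zero , refl)
inert-μ s P h (suc i) = map (λ { (gμ g) → g }) (λ { (j , e) → suc j , cong (rename suc) e }) (h i)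

var-no-step : IsVar P → ¬ (P —[ α ]→ X)
var-no-step (j , refl) ()

var-no-clock : IsVar P → ¬ (P —σ→ X)
var-no-clock (j , refl) ()

step-subst⁻¹ : (s : Fin m → Term n) (P : Term m) → Inert s P → subst s P —[ α ]→ X →
               Σ (Term m) λ Y → (P —[ α ]→ Y) × X ≡ subst s Y
step-subst⁻¹ s (var i) h t with h i
... | inj₁ (gvar ne) = ⊥-elim (ne refl)
... | inj₂ v         = ⊥-elim (var-no-step v t)
step-subst⁻¹ s (β ∙ P) h pre = P , pre , refl
step-subst⁻¹ s (σ∙ P) h (delay t) with step-subst⁻¹ s P (onUnguarded-σ h) t
... | Y , t′ , refl = Y , delay t′ , refl
step-subst⁻¹ s (P ⊕ Q) h (sumₗ t) with step-subst⁻¹ s P (onUnguarded-⊕ˡ h) t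
... | Y , t′ , refl = Y , sumₗ t′ , refl
step-subst⁻¹ s (P ⊕ Q) h (sumᵣ t) with step-subst⁻¹ s Q (onUnguarded-⊕ʳ h) t
... | Y , t′ , refl = Y , sumᵣ t′ , refl
step-subst⁻¹ s (P ∥ Q) h (parₗ t) with step-subst⁻¹ s P (onUnguarded-∥ˡ h) t
... | Y , t′ , refl = (Y ∥ Q) , parₗ t′ , refl
step-subst⁻¹ s (P ∥ Q) h (parᵣ t) with step-subst⁻¹ s Q (onUnguarded-∥ʳ h) t
... | Y , t′ , refl = (P ∥ Y) , parᵣ t′ , refl
step-subst⁻¹ s (P ∥ Q) h (com t u)
  with step-subst⁻¹ s P (onUnguarded-∥ˡ h) t | step-subst⁻¹ s Q (onUnguarded-∥ʳ h) u
... | Y , t′ , refl | Z , u′ , refl = (Y ∥ Z) , com t′ u′ , refl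
step-subst⁻¹ s (P ∖ L) h (res r t) with step-subst⁻¹ s P (onUnguarded-∖ h) t
... | Y , t′ , refl = Y ∖ L , res r t′ , refl
step-subst⁻¹ s (P [ f ]) h (rel t) with step-subst⁻¹ s P (onUnguarded-[] h) t
... | Y , t′ , refl = Y [ f ] , rel t′ , refl
step-subst⁻¹ s (μ P) h (rec t) with step-subst⁻¹ (exts s) P (inert-μ s P h) t
... | Y , t′ , refl = Y ⟨ μ P ⟩ , rec t′ , sym (subst-⟨⟩ s Y (μ P))

clock-subst⁻¹ : (s : Fin m → Term n) (P : Term m) → Inert s P → subst s P —σ→ X →
                Σ (Term m) λ Y → (P —σ→ Y) × X ≡ subst s Y
clock-subst⁻¹ s 𝟎 h nil = 𝟎 , nil , refl
clock-subst⁻¹ s (var i) h t with h i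
... | inj₁ (gvar ne) = ⊥-elim (ne refl)
... | inj₂ v         = ⊥-elim (var-no-clock v t)
clock-subst⁻¹ s (vis a ∙ P) h idle = vis a ∙ P , idle , refl
clock-subst⁻¹ s (σ∙ P) h tick = P , tick , refl
clock-subst⁻¹ s (P ⊕ Q) h (sum t u)
  with clock-subst⁻¹ s P (onUnguarded-⊕ˡ h) t | clock-subst⁻¹ s Q (onUnguarded-⊕ʳ h) u
... | Y , t′ , refl | Z , u′ , refl = Y ⊕ Z , sum t′ u′ , refl
clock-subst⁻¹ s (P ∥ Q) h (par t u no-τ)
  with clock-subst⁻¹ s P (onUnguarded-∥ˡ h) t | clock-subst⁻¹ s Q (onUnguarded-∥ʳ h) u
... | Y , t′ , refl | Z , u′ , refl =
  (Y ∥ Z) , par t′ u′ (no-τ ∘ 𝒰-subst s (P ∥ Q) τ) , refl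
clock-subst⁻¹ s (P ∖ L) h (res t) with clock-subst⁻¹ s P (onUnguarded-∖ h) t
... | Y , t′ , refl = Y ∖ L , res t′ , refl
clock-subst⁻¹ s (P [ f ]) h (rel t) with clock-subst⁻¹ s P (onUnguarded-[] h) t
... | Y , t′ , refl = Y [ f ] , rel t′ , refl
clock-subst⁻¹ s (μ P) h (rec t) with clock-subst⁻¹ (exts s) P (inert-μ s P h) t
... | Y , t′ , refl = Y ⟨ μ P ⟩ , rec t′ , sym (subst-⟨⟩ s Y (μ P))

⪰-wf : P′ ⪰ P → WF P
⪰-wf (⪰refl w)  = w
⪰-wf (⪰σ w)     = wfσ w
⪰-wf (⪰par p q) = wf∥ (⪰-wf p) (⪰-wf q)
⪰-wf (⪰sum p q) = wf⊕ (⪰-wf p) (⪰-wf q)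
⪰-wf (⪰res p)   = wf∖ (⪰-wf p)
⪰-wf (⪰rel p)   = wf[] (⪰-wf p)
⪰-wf (⪰rec p g) = wfμ g (⪰-wf p)

⪰-guarded : {x : Fin n} → P′ ⪰ P → Guarded x P → Guarded x P′
⪰-guarded (⪰refl w)  g          = g
⪰-guarded (⪰σ w)     (gσ g)     = g
⪰-guarded (⪰par p q) (g∥ g g′)  = g∥ (⪰-guarded p g) (⪰-guarded q g′)
⪰-guarded (⪰sum p q) (g⊕ g g′)  = g⊕ (⪰-guarded p g) (⪰-guarded q g′)
⪰-guarded (⪰res p)   (g∖ g)     = g∖ (⪰-guarded p g)
⪰-guarded (⪰rel p)   (g[] g)    = g[] (⪰-guarded p g)
⪰-guarded {x = x} (⪰rec {P} {P′} p _) (gμ g) = guarded-subst (sub₀ (μ P)) P′ h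
  where
  h : OnUnguarded (λ i → Guarded x (sub₀ (μ P) i)) P′
  h zero    = inj₂ (gμ g)
  h (suc i) with i ≟ x
  ... | yes refl = inj₁ (⪰-guarded p g)
  ... | no ne    = inj₂ (gvar ne)

⪰-subst : (s : Fin m → Term n) → (∀ i → WF (s i)) → P′ ⪰ P → subst s P′ ⪰ subst s P
⪰-subst s ws (⪰refl w)  = ⪰refl (wf-subst s ws w)
⪰-subst s ws (⪰σ w)     = ⪰σ (wf-subst s ws w)
⪰-subst s ws (⪰par p q) = ⪰par (⪰-subst s ws p) (⪰-subst s ws q)
⪰-subst s ws (⪰sum p q) = ⪰sum (⪰-subst s ws p) (⪰-subst s ws q)
⪰-subst s ws (⪰res p)   = ⪰res (⪰-subst s ws p)
⪰-subst s ws (⪰rel p)   = ⪰rel (⪰-subst s ws p)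
⪰-subst s ws (⪰rec {P} {P′} p g) rewrite subst-⟨⟩ s P′ (μ P) =
  ⪰rec (⪰-subst (exts s) (wf-exts ws) p) (guarded-subst-exts s P g)

step-wf : WF P → P —[ α ]→ X → WF X
step-wf (wfact w)   pre        = w
step-wf (wfσ w)     (delay t)  = step-wf w t
step-wf (wfμ g w)   (rec t)    = wf-subst _ (wf-sub₀ (wfμ g w)) (step-wf w t)
step-wf (wf⊕ w w′)  (sumₗ t)   = step-wf w t
step-wf (wf⊕ w w′)  (sumᵣ t)   = step-wf w′ t
step-wf (wf∥ w w′)  (parₗ t)   = wf∥ (step-wf w t) w′
step-wf (wf∥ w w′)  (parᵣ t)   = wf∥ w (step-wf w′ t)
step-wf (wf[] w)    (rel t)    = wf[] (step-wf w t)
step-wf (wf∖ w)     (res r t)  = wf∖ (step-wf w t)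
step-wf (wf∥ w w′)  (com t u)  = wf∥ (step-wf w t) (step-wf w′ u)

clock-⪰ : WF P → P —σ→ X → X ⪰ P
clock-⪰ w         nil          = ⪰refl w
clock-⪰ w         idle         = ⪰refl w
clock-⪰ (wfσ w)   tick         = ⪰σ w
clock-⪰ (wfμ g w) (rec t)      = ⪰rec (clock-⪰ w t) g
clock-⪰ (wf∖ w)   (res t)      = ⪰res (clock-⪰ w t)
clock-⪰ (wf[] w)  (rel t)      = ⪰rel (clock-⪰ w t)
clock-⪰ (wf⊕ w w′) (sum t u)   = ⪰sum (clock-⪰ w t) (clock-⪰ w′ u)
clock-⪰ (wf∥ w w′) (par t u _) = ⪰par (clock-⪰ w t) (clock-⪰ w′ u)

clock-wf : WF P → P —σ→ X → WF X
clock-wf w          nil          = w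
clock-wf w          idle         = w
clock-wf (wfσ w)    tick         = w
clock-wf (wfμ g w)  (rec t)      = wf-subst _ (wf-sub₀ (wfμ g w)) (clock-wf w t)
clock-wf (wf∖ w)    (res t)      = wf∖ (clock-wf w t)
clock-wf (wf[] w)   (rel t)      = wf[] (clock-wf w t)
clock-wf (wf⊕ w w′) (sum t u)    = wf⊕ (clock-wf w t) (clock-wf w′ u)
clock-wf (wf∥ w w′) (par t u _)  = wf∥ (clock-wf w t) (clock-wf w′ u)

-- FasterClauses R P Q unfolds to  StepSim R P Q × StepSim (flip R) Q P × ClockSim R P Q.
StepSim : (Term n → Term n → Set) → Term n → Term n → Set
StepSim R P Q = ∀ α P′ → P —[ α ]→ P′ → Σ (Term _) λ Q′ → (Q —[ α ]→ Q′) × R P′ Q′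

ClockSim : (Term n → Term n → Set) → Term n → Term n → Set
ClockSim R P Q = ∀ P′ → P —σ→ P′ → Q ⊆U P × (Σ (Term _) λ Q′ → (Q —σ→ Q′) × R P′ Q′)

⊆U-∥ : P′ ⊆U P → Q′ ⊆U Q → (P′ ∥ Q′) ⊆U (P ∥ Q)
⊆U-∥ urgP urgQ α (inj₁ u)        = inj₁ (urgP α u)
⊆U-∥ urgP urgQ α (inj₂ (inj₁ u)) = inj₂ (inj₁ (urgQ α u))
⊆U-∥ urgP urgQ α (inj₂ (inj₂ (e , a , u , v))) = inj₂ (inj₂ (e , a , urgP _ u , urgQ _ v))

module _ {R : Term n → Term n → Set} where

  stepSim-⊕ : StepSim R P P′ → StepSim R Q Q′ → StepSim R (P ⊕ Q) (P′ ⊕ Q′)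
  stepSim-⊕ simP simQ α _ (sumₗ t) = let Y , t′ , r = simP α _ t in Y , sumₗ t′ , r
  stepSim-⊕ simP simQ α _ (sumᵣ t) = let Y , t′ , r = simQ α _ t in Y , sumᵣ t′ , r

  stepSim-∥ : (∀ {A A′ B B′} → R A A′ → R B B′ → R (A ∥ B) (A′ ∥ B′)) →
              R P P′ → R Q Q′ → StepSim R P P′ → StepSim R Q Q′ → StepSim R (P ∥ Q) (P′ ∥ Q′)
  stepSim-∥ _∥ᴿ_ p q simP simQ α _ (parₗ t) =
    let Y , t′ , r = simP α _ t in (Y ∥ _) , parₗ t′ , r ∥ᴿ q
  stepSim-∥ _∥ᴿ_ p q simP simQ α _ (parᵣ t) =
    let Y , t′ , r = simQ α _ t in (_ ∥ Y) , parᵣ t′ , p ∥ᴿ r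
  stepSim-∥ _∥ᴿ_ p q simP simQ α _ (com t u) =
    let Y , t′ , r = simP _ _ t ; Z , u′ , r′ = simQ _ _ u in (Y ∥ Z) , com t′ u′ , r ∥ᴿ r′

  stepSim-∖ : ∀ {L} → (∀ {A A′} → R A A′ → R (A ∖ L) (A′ ∖ L)) →
              StepSim R P P′ → StepSim R (P ∖ L) (P′ ∖ L)
  stepSim-∖ resᴿ simP α _ (res nr t) = let Y , t′ , r = simP α _ t in Y ∖ _ , res nr t′ , resᴿ r

  stepSim-[] : ∀ {f} → (∀ {A A′} → R A A′ → R (A [ f ]) (A′ [ f ])) →
               StepSim R P P′ → StepSim R (P [ f ]) (P′ [ f ])
  stepSim-[] relᴿ simP _ _ (rel t) = let Y , t′ , r = simP _ _ t in Y [ _ ] , rel t′ , relᴿ r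

  clockSim-⊕ : (∀ {A A′ B B′} → R A A′ → R B B′ → R (A ⊕ B) (A′ ⊕ B′)) →
               ClockSim R P P′ → ClockSim R Q Q′ → ClockSim R (P ⊕ Q) (P′ ⊕ Q′)
  clockSim-⊕ _⊕ᴿ_ simP simQ _ (sum t u) =
    let urgP , Y , t′ , r = simP _ t ; urgQ , Z , u′ , r′ = simQ _ u
    in (λ α → map (urgP α) (urgQ α)) , (Y ⊕ Z) , sum t′ u′ , r ⊕ᴿ r′

  clockSim-∥ : (∀ {A A′ B B′} → R A A′ → R B B′ → R (A ∥ B) (A′ ∥ B′)) →
               ClockSim R P P′ → ClockSim R Q Q′ → ClockSim R (P ∥ Q) (P′ ∥ Q′)
  clockSim-∥ {P = P} {P′ = P′} {Q = Q} {Q′ = Q′} _∥ᴿ_ simP simQ _ (par t u no-τ) =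
    let urgP , Y , t′ , r = simP _ t ; urgQ , Z , u′ , r′ = simQ _ u
        urg = ⊆U-∥ {P′ = P′} {P = P} {Q′ = Q′} {Q = Q} urgP urgQ
    in urg , (Y ∥ Z) , par t′ u′ (no-τ ∘ urg τ) , r ∥ᴿ r′

  clockSim-∖ : ∀ {L} → (∀ {A A′} → R A A′ → R (A ∖ L) (A′ ∖ L)) →
               ClockSim R P P′ → ClockSim R (P ∖ L) (P′ ∖ L)
  clockSim-∖ resᴿ simP _ (res t) =
    let urg , Y , t′ , r = simP _ t
    in (λ { α (u , nr) → urg α u , nr }) , Y ∖ _ , res t′ , resᴿ r

  clockSim-[] : ∀ {f} → (∀ {A A′} → R A A′ → R (A [ f ]) (A′ [ f ])) →
                ClockSim R P P′ → ClockSim R (P [ f ]) (P′ [ f ])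
  clockSim-[] relᴿ simP _ (rel t) =
    let urg , Y , t′ , r = simP _ t
    in (λ { α (β , u , e) → β , urg β u , e }) , Y [ _ ] , rel t′ , relᴿ r

faster-refl : WF P → FasterClauses _⪰_ P P
faster-refl w =
  (λ α X t → X , t , ⪰refl (step-wf w t)) ,
  (λ α X t → X , t , ⪰refl (step-wf w t)) ,
  (λ X t → (λ α u → u) , X , t , ⪰refl (clock-wf w t))

faster-σ : WF P → FasterClauses _⪰_ P (σ∙ P)
faster-σ w =
  (λ α X t → X , delay t , ⪰refl (step-wf w t)) ,
  (λ { α X (delay t) → X , t , ⪰refl (step-wf w t) }) ,
  (λ X t → (λ α ()) , _ , tick , clock-⪰ w t)

faster-rec : P′ ⪰ P → Guarded zero P → FasterClauses _⪰_ P′ P →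
             FasterClauses _⪰_ (P′ ⟨ μ P ⟩) (μ P)
faster-rec {P′ = P′} {P = P} p g (fwd , bwd , clock) = fwd′ , bwd′ , clock′
  where
  inert : Inert (sub₀ (μ P)) P′
  inert zero    = inj₁ (⪰-guarded p g)
  inert (suc i) = inj₂ (i , refl)

  ⪰-unfold : ∀ {Y Z} → Y ⪰ Z → Y ⟨ μ P ⟩ ⪰ Z ⟨ μ P ⟩
  ⪰-unfold = ⪰-subst (sub₀ (μ P)) (wf-sub₀ (wfμ g (⪰-wf p)))

  fwd′ : StepSim _⪰_ (P′ ⟨ μ P ⟩) (μ P)
  fwd′ α X t with step-subst⁻¹ (sub₀ (μ P)) P′ inert t
  ... | Y , t′ , refl = let Z , u , r = fwd α Y t′ in Z ⟨ μ P ⟩ , rec u , ⪰-unfold r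

  bwd′ : StepSim (flip _⪰_) (μ P) (P′ ⟨ μ P ⟩)
  bwd′ α _ (rec t) = let Y , u , r = bwd α _ t in Y ⟨ μ P ⟩ , step-subst _ u , ⪰-unfold r

  clock′ : ClockSim _⪰_ (P′ ⟨ μ P ⟩) (μ P)
  clock′ X t with clock-subst⁻¹ (sub₀ (μ P)) P′ inert t
  ... | Y , t′ , refl =
    let urg , Z , u , r = clock Y t′
    in (λ α → 𝒰-subst _ P′ α ∘ urg α) , Z ⟨ μ P ⟩ , rec u , ⪰-unfold r

⪰-faster : P′ ⪰ P → FasterClauses _⪰_ P′ P
⪰-faster (⪰refl w)  = faster-refl w
⪰-faster (⪰σ w)     = faster-σ w
⪰-faster (⪰par p q) with ⪰-faster p | ⪰-faster q
... | fwdP , bwdP , clockP | fwdQ , bwdQ , clockQ =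
  stepSim-∥ ⪰par p q fwdP fwdQ , stepSim-∥ ⪰par p q bwdP bwdQ , clockSim-∥ ⪰par clockP clockQ
⪰-faster (⪰sum p q) with ⪰-faster p | ⪰-faster q
... | fwdP , bwdP , clockP | fwdQ , bwdQ , clockQ =
  stepSim-⊕ fwdP fwdQ , stepSim-⊕ bwdP bwdQ , clockSim-⊕ ⪰sum clockP clockQ
⪰-faster (⪰res p) with ⪰-faster p
... | fwd , bwd , clock = stepSim-∖ ⪰res fwd , stepSim-∖ ⪰res bwd , clockSim-∖ ⪰res clock
⪰-faster (⪰rel p) with ⪰-faster p
... | fwd , bwd , clock = stepSim-[] ⪰rel fwd , stepSim-[] ⪰rel bwd , clockSim-[] ⪰rel clock
⪰-faster (⪰rec p g) = faster-rec p g (⪰-faster p)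

module _ {R S : Term n → Term n → Set} where

  faster-map : (∀ {A B} → R A B → S A B) → FasterClauses R P Q → FasterClauses S P Q
  faster-map f (fwd , bwd , clock) =
    (λ α X t → let Y , t′ , r = fwd α X t in Y , t′ , f r) ,
    (λ α X t → let Y , t′ , r = bwd α X t in Y , t′ , f r) ,
    (λ X t → let urg , Y , t′ , r = clock X t in urg , Y , t′ , f r)

  faster-compose : {T : Term n → Term n → Set} → (∀ {A B C} → R A B → S B C → T A C) →
                   FasterClauses R P Q → FasterClauses S Q X → FasterClauses T P X
  faster-compose _⨾_ (fwdR , bwdR , clockR) (fwdS , bwdS , clockS) =
    (λ α A t → let B , t′ , r = fwdR α A t ; C , t″ , s = fwdS α B t′ in C , t″ , r ⨾ s) ,
    (λ α C t → let B , t′ , s = bwdS α C t ; A , t″ , r = bwdR α B t′ in A , t″ , r ⨾ s) ,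
    (λ A t → let urgR , B , t′ , r = clockR A t ; urgS , C , t″ , s = clockS B t′
             in (λ α → urgR α ∘ urgS α) , C , t″ , r ⨾ s)

faster⁺ : {R : Term n → Term n → Set} → (∀ {A B} → R A B → FasterClauses R A B) →
          TransClosure R P Q → FasterClauses (TransClosure R) P Q
faster⁺ faster [ r ]⁺    = faster-map [_]⁺ (faster r)
faster⁺ faster (r ∷ rs) = faster-compose _∷_ (faster r) (faster⁺ faster rs)

⪰⁺-faster : P′ ⪰⁺ P → FasterClauses _⪰⁺_ P′ P
⪰⁺-faster = faster⁺ ⪰-faster

proposition16 : (∀ {n} (P Q : Term n) → P ⪰⁺ Q → FasterClauses _⪰⁺_ P Q)
    × IsStrong1Faster (λ P Q → P ⪰⁺ Q)
    × (∀ (P Q : Process) → P ⪰⁺ Q → P ⊒₁ Q)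
proposition16 =
  (λ P Q → ⪰⁺-faster) ,
  (λ P Q → ⪰⁺-faster) ,
  (λ P Q r → _⪰⁺_ , (λ P Q → ⪰⁺-faster) , r)
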